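{- The following two rules are admissible in $\mathbf{G}(\mathsf{FBInqBQ})$: (a) for every label $X$, if $\{k\}:\varphi,\Gamma\Rightarrow\Delta$ is derivable for every $k\in X$, then $\Gamma\Rightarrow\Delta,X:\neg\varphi$ is derivable; (b) for all labels $X\supseteq Y$, if $\Gamma\Rightarrow\Delta,Y:\varphi$ is derivable, then $X:\neg\varphi,\Gamma\Rightarrow\Delta$ is derivable.
   Context: Language: countably infinite set of variables, countably infinite set of predicate symbols with arities (no identity, constants, function symbols). Formulas: $\varphi ::= P(x_1,\dots,x_m)\mid \bot\mid \varphi\to\varphi\mid\varphi\wedge\varphi\mid \varphi\veebar\varphi\mid \forall x\varphi\mid \bar\exists x\varphi$ ($\veebar$ inquisitive disjunction, $\bar\exists$ inquisitive existential); $\neg\varphi:=\varphi\to\bot$. $\varphi[z/x]$ is capture-avoiding substitution. Calculus $\mathbf{G}(\mathsf{FBInqBQ})$: a label is a nonempty finite subset of $\omega$; a labelled formula is $X:\varphi$ with $X$ a label; a sequent $\Gamma\Rightarrow\Delta$ is a pair of finite multisets of labelled formulas. $X,Y$ range over labels. Initial sequents: $(\mathtt{id})$ $X:P(\bar x),\Gamma\Rightarrow\Delta,Y:P(\bar x)$ whenever $X\supseteq Y$; $(\bot\Rightarrow)$ $X:\bot,\Gamma\Rightarrow\Delta$. Rules (premises / conclusion): $(\Rightarrow\mathtt{at})$: $\Gamma\Rightarrow\Delta,\{k\}:P(\bar x)$ for every $k\in X$ / $\Gamma\Rightarrow\Delta,X:P(\bar x)$. $(\Rightarrow\wedge)$: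 $\Gamma\Rightarrow\Delta,X:\varphi$ and $\Gamma\Rightarrow\Delta,X:\psi$ / $\Gamma\Rightarrow\Delta,X:\varphi\wedge\psi$. $(\wedge\Rightarrow)$: $X:\varphi,X:\psi,\Gamma\Rightarrow\Delta$ / $X:\varphi\wedge\psi,\Gamma\Rightarrow\Delta$. $(\Rightarrow\veebar)$: $\Gamma\Rightarrow\Delta,X:\varphi,X:\psi$ / $\Gamma\Rightarrow\Delta,X:\varphi\veebar\psi$. $(\veebar\Rightarrow)$: $X:\varphi,\Gamma\Rightarrow\Delta$ and $X:\psi,\Gamma\Rightarrow\Delta$ / $X:\varphi\veebar\psi,\Gamma\Rightarrow\Delta$. $(\Rightarrow\to)$: $Y:\varphi,\Gamma\Rightarrow\Delta,Y:\psi$ for every label $Y\subseteq X$ / $\Gamma\Rightarrow\Delta,X:\varphi\to\psi$. $(\to\Rightarrow)$, for a label $Y\subseteq X$: $X:\varphi\to\psi,\Gamma\Rightarrow\Delta,Y:\varphi$ and $Y:\psi,X:\varphi\to\psi,\Gamma\Rightarrow\Delta$ / $X:\varphi\to\psi,\Gamma\Rightarrow\Delta$. $(\Rightarrow\forall)$: $\Gamma\Rightarrow\Delta,X:\varphi[z/x]$ / $\Gamma\Rightarrow\Delta,X:\forall x\varphi$, with $z$ not occurring in the conclusion. $(\forall\Rightarrow)$: $X:\varphi[y/x],X:\forall x\varphi,\Gamma\Rightarrow\Delta$ / $X:\forall x\varphi,\Gamma\Rightarrow\Delta$ ($y$ arbitrary). $(\Rightarrow\bar\exists)$: $\Gamma\Rightarrow\Delta,X:\bar\exists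 x\varphi,X:\varphi[y/x]$ / $\Gamma\Rightarrow\Delta,X:\bar\exists x\varphi$ ($y$ arbitrary). $(\bar\exists\Rightarrow)$: $X:\varphi[z/x],\Gamma\Rightarrow\Delta$ / $X:\bar\exists x\varphi,\Gamma\Rightarrow\Delta$, with $z$ not occurring in the conclusion. A derivation is a finite tree of sequents built from initial sequents by these rules; a sequent is derivable if it is the root of a derivation. -}

module Defs where

open import Data.Nat using (ℕ; suc; _<_; _≡ᵇ_; _⊔_)
open import Data.Bool using (Bool; true; false; if_then_else_)
open import Data.Product using (_×_; _,_; proj₂)
open import Data.List using (List; []; _∷_; _++_; map; foldr; filterᵇ; concatMap)
open import Data.Bool.ListAction using (any)
open import Data.List.Relation.Unary.Linked using (Linked; [-])
open import Data.List.Membership.Propositional using (_∈_; _∉_)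
open import Data.List.Relation.Binary.Permutation.Propositional using (_↭_)
open import Data.Vec using (Vec; toList)
import Data.Vec as Vec

Var : Set
Var = ℕ

record PredSym : Set where
  constructor psym
  field
    name  : ℕ
    arity : ℕ
open PredSym public

infixr 6 _∧'_ _⩒_
infixr 5 _⇒'_

data Fm : Set where
  atom : (P : PredSym) → Vec Var (arity P) → Fm
  ⊥'   : Fm
  _⇒'_ : Fm → Fm → Fm
  _∧'_ : Fm → Fm → Fm
  _⩒_  : Fm → Fm → Fm
  ∀'   : Var → Fm → Fm
  ∃̄    : Var → Fm → Fm

¬' : Fm → Fm
¬' φ = φ ⇒' ⊥'

vars : Fm → List Var
vars (atom P xs) = toList xs
vars ⊥' = []
vars (φ ⇒' ψ) = vars φ ++ vars ψ
vars (φ ∧' ψ) = vars φ ++ vars ψ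
vars (φ ⩒ ψ) = vars φ ++ vars ψ
vars (∀' x φ) = x ∷ vars φ
vars (∃̄ x φ) = x ∷ vars φ

fv : Fm → List Var
fv (atom P xs) = toList xs
fv ⊥' = []
fv (φ ⇒' ψ) = fv φ ++ fv ψ
fv (φ ∧' ψ) = fv φ ++ fv ψ
fv (φ ⩒ ψ) = fv φ ++ fv ψ
fv (∀' x φ) = filterᵇ (λ v → if v ≡ᵇ x then false else true) (fv φ)
fv (∃̄ x φ) = filterᵇ (λ v → if v ≡ᵇ x then false else true) (fv φ)

maxL : List ℕ → ℕ
maxL = foldr _⊔_ 0

_[_↦_] : (Var → Var) → Var → Var → (Var → Var)
(σ [ x ↦ y ]) v = if v ≡ᵇ x then y else σ v

-- Capture-avoiding simultaneous renaming: a bound variable is renamed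
-- (to a fresh one) only when it would capture the image of a free variable.
ren : (Var → Var) → Fm → Fm
renBinder : (Var → Fm → Fm) → (Var → Var) → Var → Fm → Fm
ren σ (atom P xs) = atom P (Vec.map σ xs)
ren σ ⊥' = ⊥'
ren σ (φ ⇒' ψ) = ren σ φ ⇒' ren σ ψ
ren σ (φ ∧' ψ) = ren σ φ ∧' ren σ ψ
ren σ (φ ⩒ ψ) = ren σ φ ⩒ ren σ ψ
ren σ (∀' w φ) = renBinder ∀' σ w φ
ren σ (∃̄ w φ) = renBinder ∃̄ σ w φ
renBinder Q σ w φ =
  let clash = any (λ v → σ v ≡ᵇ w) (fv (∀' w φ))
      w'    = if clash then suc (maxL (vars φ ++ map σ (fv φ)) ⊔ w) else w
  in Q w' (ren (σ [ w ↦ w' ]) φ)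

_[_/_] : Fm → Var → Var → Fm
φ [ z / x ] = ren (λ v → if v ≡ᵇ x then z else v) φ

-- Labels: nonempty finite subsets of ω, represented canonically as
-- strictly increasing nonempty lists.

record Label : Set where
  constructor lbl
  field
    least  : ℕ
    others : List ℕ
    sorted : Linked _<_ (least ∷ others)
open Label public

elems : Label → List ℕ
elems X = least X ∷ others X

_∈L_ : ℕ → Label → Set
k ∈L X = k ∈ elems X

_⊆L_ : Label → Label → Set
Y ⊆L X = ∀ k → k ∈L Y → k ∈L X

sing : ℕ → Label
sing k = lbl k [] [-]

infix 4 _∶_
record LFm : Set where
  constructor _∶_
  field
    lab : Label
    fm  : Fm
open LFm public

varsCtx : List LFm → List Var
varsCtx = concatMap (λ A → vars (fm A))

-- Sequents are pairs of lists of labelled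
-- formulas; the rule `perm` makes them behave as multisets.  In every rule
-- the principal formula is written at the head of the list.

infix 2 ⊢_⇒_

data ⊢_⇒_ : List LFm → List LFm → Set where
  perm  : ∀ {Γ Γ' Δ Δ'} → Γ ↭ Γ' → Δ ↭ Δ' → ⊢ Γ ⇒ Δ → ⊢ Γ' ⇒ Δ'
  id    : ∀ {X Y P xs Γ Δ} → Y ⊆L X →
          ⊢ (X ∶ atom P xs) ∷ Γ ⇒ (Y ∶ atom P xs) ∷ Δ
  ⊥⇒    : ∀ {X Γ Δ} → ⊢ (X ∶ ⊥') ∷ Γ ⇒ Δ
  ⇒at   : ∀ {X P xs Γ Δ} →
          (∀ k → k ∈L X → ⊢ Γ ⇒ (sing k ∶ atom P xs) ∷ Δ) →
          ⊢ Γ ⇒ (X ∶ atom P xs) ∷ Δ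
  ⇒∧    : ∀ {X φ ψ Γ Δ} → ⊢ Γ ⇒ (X ∶ φ) ∷ Δ → ⊢ Γ ⇒ (X ∶ ψ) ∷ Δ →
          ⊢ Γ ⇒ (X ∶ φ ∧' ψ) ∷ Δ
  ∧⇒    : ∀ {X φ ψ Γ Δ} → ⊢ (X ∶ φ) ∷ (X ∶ ψ) ∷ Γ ⇒ Δ →
          ⊢ (X ∶ φ ∧' ψ) ∷ Γ ⇒ Δ
  ⇒⩒    : ∀ {X φ ψ Γ Δ} → ⊢ Γ ⇒ (X ∶ φ) ∷ (X ∶ ψ) ∷ Δ →
          ⊢ Γ ⇒ (X ∶ φ ⩒ ψ) ∷ Δ
  ⩒⇒    : ∀ {X φ ψ Γ Δ} → ⊢ (X ∶ φ) ∷ Γ ⇒ Δ → ⊢ (X ∶ ψ) ∷ Γ ⇒ Δ →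
          ⊢ (X ∶ φ ⩒ ψ) ∷ Γ ⇒ Δ
  ⇒→    : ∀ {X φ ψ Γ Δ} →
          (∀ Y → Y ⊆L X → ⊢ (Y ∶ φ) ∷ Γ ⇒ (Y ∶ ψ) ∷ Δ) →
          ⊢ Γ ⇒ (X ∶ φ ⇒' ψ) ∷ Δ
  →⇒    : ∀ {X Y φ ψ Γ Δ} → Y ⊆L X →
          ⊢ (X ∶ φ ⇒' ψ) ∷ Γ ⇒ (Y ∶ φ) ∷ Δ →
          ⊢ (Y ∶ ψ) ∷ (X ∶ φ ⇒' ψ) ∷ Γ ⇒ Δ →
          ⊢ (X ∶ φ ⇒' ψ) ∷ Γ ⇒ Δ
  ⇒∀    : ∀ {X x z φ Γ Δ} →
          z ∉ (vars (∀' x φ) ++ varsCtx Γ ++ varsCtx Δ) →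
          ⊢ Γ ⇒ (X ∶ φ [ z / x ]) ∷ Δ →
          ⊢ Γ ⇒ (X ∶ ∀' x φ) ∷ Δ
  ∀⇒    : ∀ {X x y φ Γ Δ} →
          ⊢ (X ∶ φ [ y / x ]) ∷ (X ∶ ∀' x φ) ∷ Γ ⇒ Δ →
          ⊢ (X ∶ ∀' x φ) ∷ Γ ⇒ Δ
  ⇒∃̄    : ∀ {X x y φ Γ Δ} →
          ⊢ Γ ⇒ (X ∶ ∃̄ x φ) ∷ (X ∶ φ [ y / x ]) ∷ Δ →
          ⊢ Γ ⇒ (X ∶ ∃̄ x φ) ∷ Δ
  ∃̄⇒    : ∀ {X x z φ Γ Δ} →
          z ∉ (vars (∃̄ x φ) ++ varsCtx Γ ++ varsCtx Δ) →
          ⊢ (X ∶ φ [ z / x ]) ∷ Γ ⇒ Δ →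
          ⊢ (X ∶ ∃̄ x φ) ∷ Γ ⇒ Δ

-- Both rules are single logical steps once weakening and label monotonicity (antecedent
-- labels may grow, succedent labels shrink) are admissible: (a) is (⇒→), each premise at
-- Y ⊆ X coming from the hypothesis at {min Y} ⊆ Y weakened by Y : ⊥; (b) is (→⇒) at Y,
-- with the weakened hypothesis as left premise and (⊥⇒) as right premise.
-- Weakening must rename eigenvariables that occur in the added formulas, so it is proved
-- for all sequents obtained from the given one by renaming free variables; formulas are
-- compared through a locally nameless translation, under which α-variants coincide.
{-# OPTIONS --safe #-}
module Submission where

open import Defs
open import Data.Product using (_×_; Σ; ∃; ∃₂; _,_)
open import Data.List using (List; _∷_; []; [_]; _++_; map)

open import Data.Bool using (true; false; if_then_else_; T)
open import Data.Bool.ListAction using (any)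
open import Data.List.Membership.Propositional using (_∈_; _∉_; lose)
open import Data.List.Membership.Propositional.Properties using (∈-++⁺ˡ; ∈-++⁺ʳ; ∈-map⁺; ∈-filter⁺)
open import Data.List.Relation.Binary.Permutation.Propositional using (_↭_; refl; prep; swap; trans)
open import Data.List.Relation.Binary.Permutation.Propositional.Properties using (++⁺ʳ; ++-comm; ++-identityʳ)
open import Data.List.Relation.Binary.Pointwise as Pointwise using (Pointwise; []; _∷_)
open import Data.List.Relation.Unary.Any using (here; there)
open import Data.List.Relation.Unary.Any.Properties using (any⁺)
open import Data.Nat using (ℕ; zero; suc; _≡ᵇ_; _⊔_; _≤_; s≤s)
open import Data.Nat.Properties using (_≟_; ≡⇒≡ᵇ; ≡ᵇ⇒≡; m≤m⊔n; m≤n⊔m; ≤-trans; <⇒≢)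
open import Data.Sum using (_⊎_; inj₁; inj₂)
open import Data.Unit using (tt)
open import Data.Vec using (Vec; toList) renaming ([] to []ᵛ; _∷_ to _∷ᵛ_)
import Data.Vec as Vec
open import Data.Vec.Properties using (map-cong; map-∘; map-id; ∷-injective)
open import Function using (_∘_; flip)
open import Relation.Binary.PropositionalEquality
  using (_≡_; _≢_; _≗_; refl; sym; cong; cong₂; subst; module ≡-Reasoning)
  renaming (trans to ≡-trans)
open import Relation.Nullary using (yes; no; contradiction)

if-≡ᵇ-refl : ∀ {A : Set} w {a b : A} → (if w ≡ᵇ w then a else b) ≡ a
if-≡ᵇ-refl w with w ≡ᵇ w | ≡⇒≡ᵇ w w refl
... | true | _ = refl

if-≡ᵇ-≢ : ∀ {A : Set} {v w} {a b : A} → v ≢ w → (if v ≡ᵇ w then a else b) ≡ b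
if-≡ᵇ-≢ {v = v} {w} v≢w with v ≡ᵇ w | ≡ᵇ⇒≡ v w
... | true  | v≡w = contradiction (v≡w tt) v≢w
... | false | _   = refl

≤-maxL : ∀ {n} ns → n ∈ ns → n ≤ maxL ns
≤-maxL (n ∷ ns) (here refl) = m≤m⊔n n (maxL ns)
≤-maxL (m ∷ ns) (there n∈) = ≤-trans (≤-maxL ns n∈) (m≤n⊔m m (maxL ns))

suc-maxL-∉ : ∀ ns → suc (maxL ns) ∉ ns
suc-maxL-∉ ns n∈ = <⇒≢ (≤-maxL ns n∈) refl

data Term : Set where
  fvar : Var → Term
  bvar : ℕ → Term

infixr 6 _∧ⁿ_ _⩒ⁿ_
infixr 5 _⇒ⁿ_

data Nameless : Set where
  atomⁿ : (P : PredSym) → Vec Term (arity P) → Nameless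
  ⊥ⁿ    : Nameless
  _⇒ⁿ_ _∧ⁿ_ _⩒ⁿ_ : Nameless → Nameless → Nameless
  ∀ⁿ ∃ⁿ : Nameless → Nameless

shift : Term → Term
shift (fvar u) = fvar u
shift (bvar i) = bvar (suc i)

-- The environment lists the enclosing binders, innermost first.
index : List Var → Var → Term
index []        v = fvar v
index (w ∷ env) v = if v ≡ᵇ w then bvar 0 else shift (index env v)

toNameless : List Var → Fm → Nameless
toNameless env (atom P xs) = atomⁿ P (Vec.map (index env) xs)
toNameless env ⊥'          = ⊥ⁿ
toNameless env (φ ⇒' ψ)    = toNameless env φ ⇒ⁿ toNameless env ψ
toNameless env (φ ∧' ψ)    = toNameless env φ ∧ⁿ toNameless env ψ
toNameless env (φ ⩒ ψ)     = toNameless env φ ⩒ⁿ toNameless env ψ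
toNameless env (∀' x φ)    = ∀ⁿ (toNameless (x ∷ env) φ)
toNameless env (∃̄ x φ)     = ∃ⁿ (toNameless (x ∷ env) φ)

⌊_⌋ : Fm → Nameless
⌊ φ ⌋ = toNameless [] φ

index-here : ∀ w env → index (w ∷ env) w ≡ bvar 0
index-here w env = if-≡ᵇ-refl w

index-there : ∀ {v w} env → v ≢ w → index (w ∷ env) v ≡ shift (index env v)
index-there env = if-≡ᵇ-≢

index-fvar-or-bvar : ∀ env v → (index env v ≡ fvar v) ⊎ (∃ λ i → index env v ≡ bvar i)
index-fvar-or-bvar []        v = inj₁ refl
index-fvar-or-bvar (w ∷ env) v with v ≟ w
... | yes refl = inj₂ (0 , index-here v env)
... | no v≢w with index-fvar-or-bvar env v
...   | inj₁ eq       = inj₁ (≡-trans (index-there env v≢w) (cong shift eq))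
...   | inj₂ (i , eq) = inj₂ (suc i , ≡-trans (index-there env v≢w) (cong shift eq))

lift : (Term → Term) → Term → Term
lift g (bvar zero)    = bvar zero
lift g (bvar (suc i)) = shift (g (bvar i))
lift g (fvar u)       = shift (g (fvar u))

sub : (Term → Term) → Nameless → Nameless
sub g (atomⁿ P ts) = atomⁿ P (Vec.map g ts)
sub g ⊥ⁿ           = ⊥ⁿ
sub g (a ⇒ⁿ b)     = sub g a ⇒ⁿ sub g b
sub g (a ∧ⁿ b)     = sub g a ∧ⁿ sub g b
sub g (a ⩒ⁿ b)     = sub g a ⩒ⁿ sub g b
sub g (∀ⁿ a)       = ∀ⁿ (sub (lift g) a)
sub g (∃ⁿ a)       = ∃ⁿ (sub (lift g) a)

free : (Var → Var) → Term → Term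
free σ (fvar u) = fvar (σ u)
free σ (bvar i) = bvar i

inst : Var → Term → Term
inst z (bvar zero)    = fvar z
inst z (bvar (suc i)) = bvar i
inst z (fvar u)       = fvar u

lift-cong : ∀ {g h} → g ≗ h → lift g ≗ lift h
lift-cong g≗h (bvar zero)    = refl
lift-cong g≗h (bvar (suc i)) = cong shift (g≗h (bvar i))
lift-cong g≗h (fvar u)       = cong shift (g≗h (fvar u))

sub-cong : ∀ {g h} → g ≗ h → sub g ≗ sub h
sub-cong g≗h (atomⁿ P ts) = cong (atomⁿ P) (map-cong g≗h ts)
sub-cong g≗h ⊥ⁿ           = refl
sub-cong g≗h (a ⇒ⁿ b)     = cong₂ _⇒ⁿ_ (sub-cong g≗h a) (sub-cong g≗h b)
sub-cong g≗h (a ∧ⁿ b)     = cong₂ _∧ⁿ_ (sub-cong g≗h a) (sub-cong g≗h b)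
sub-cong g≗h (a ⩒ⁿ b)     = cong₂ _⩒ⁿ_ (sub-cong g≗h a) (sub-cong g≗h b)
sub-cong g≗h (∀ⁿ a)       = cong ∀ⁿ (sub-cong (lift-cong g≗h) a)
sub-cong g≗h (∃ⁿ a)       = cong ∃ⁿ (sub-cong (lift-cong g≗h) a)

lift-shift : ∀ g t → lift g (shift t) ≡ shift (g t)
lift-shift g (fvar u) = refl
lift-shift g (bvar i) = refl

lift-∘ : ∀ g h → lift g ∘ lift h ≗ lift (g ∘ h)
lift-∘ g h (bvar zero)    = refl
lift-∘ g h (bvar (suc i)) = lift-shift g (h (bvar i))
lift-∘ g h (fvar u)       = lift-shift g (h (fvar u))

sub-∘ : ∀ g h → sub g ∘ sub h ≗ sub (g ∘ h)
sub-∘ g h (atomⁿ P ts) = cong (atomⁿ P) (sym (map-∘ g h ts))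
sub-∘ g h ⊥ⁿ           = refl
sub-∘ g h (a ⇒ⁿ b)     = cong₂ _⇒ⁿ_ (sub-∘ g h a) (sub-∘ g h b)
sub-∘ g h (a ∧ⁿ b)     = cong₂ _∧ⁿ_ (sub-∘ g h a) (sub-∘ g h b)
sub-∘ g h (a ⩒ⁿ b)     = cong₂ _⩒ⁿ_ (sub-∘ g h a) (sub-∘ g h b)
sub-∘ g h (∀ⁿ a)       = cong ∀ⁿ (≡-trans (sub-∘ (lift g) (lift h) a) (sub-cong (lift-∘ g h) a))
sub-∘ g h (∃ⁿ a)       = cong ∃ⁿ (≡-trans (sub-∘ (lift g) (lift h) a) (sub-cong (lift-∘ g h) a))

lift-id : ∀ {g} → g ≗ (λ t → t) → lift g ≗ (λ t → t)
lift-id g≗id (bvar zero)    = refl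
lift-id g≗id (bvar (suc i)) = cong shift (g≗id (bvar i))
lift-id g≗id (fvar u)       = cong shift (g≗id (fvar u))

sub-id : ∀ {g} → g ≗ (λ t → t) → sub g ≗ (λ a → a)
sub-id g≗id (atomⁿ P ts) = cong (atomⁿ P) (≡-trans (map-cong g≗id ts) (map-id ts))
sub-id g≗id ⊥ⁿ           = refl
sub-id g≗id (a ⇒ⁿ b)     = cong₂ _⇒ⁿ_ (sub-id g≗id a) (sub-id g≗id b)
sub-id g≗id (a ∧ⁿ b)     = cong₂ _∧ⁿ_ (sub-id g≗id a) (sub-id g≗id b)
sub-id g≗id (a ⩒ⁿ b)     = cong₂ _⩒ⁿ_ (sub-id g≗id a) (sub-id g≗id b)
sub-id g≗id (∀ⁿ a)       = cong ∀ⁿ (sub-id (lift-id g≗id) a)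
sub-id g≗id (∃ⁿ a)       = cong ∃ⁿ (sub-id (lift-id g≗id) a)

free-id : free (λ v → v) ≗ (λ t → t)
free-id (fvar u) = refl
free-id (bvar i) = refl

map-cong-∈ : ∀ {A B : Set} {f g : A → B} {n} (xs : Vec A n) →
             (∀ x → x ∈ toList xs → f x ≡ g x) → Vec.map f xs ≡ Vec.map g xs
map-cong-∈ []ᵛ       f≡g = refl
map-cong-∈ (x ∷ᵛ xs) f≡g = cong₂ _∷ᵛ_ (f≡g x (here refl)) (map-cong-∈ xs (λ y → f≡g y ∘ there))

lift-cong-bvar : ∀ {g h} → (∀ i → g (bvar i) ≡ h (bvar i)) → ∀ i → lift g (bvar i) ≡ lift h (bvar i)
lift-cong-bvar g≡h zero    = refl
lift-cong-bvar g≡h (suc i) = cong shift (g≡h i)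

sub-cong-vars : ∀ {g h} env φ → (∀ i → g (bvar i) ≡ h (bvar i)) →
                (∀ u → u ∈ vars φ → g (fvar u) ≡ h (fvar u)) →
                sub g (toNameless env φ) ≡ sub h (toNameless env φ)
sub-cong-vars {g} {h} env (atom P xs) g≡hᵇ g≡hᶠ = cong (atomⁿ P) (begin
  Vec.map g (Vec.map (index env) xs)  ≡⟨ map-∘ g (index env) xs ⟨
  Vec.map (g ∘ index env) xs          ≡⟨ map-cong-∈ xs g∘index≡h∘index ⟩
  Vec.map (h ∘ index env) xs          ≡⟨ map-∘ h (index env) xs ⟩
  Vec.map h (Vec.map (index env) xs)  ∎)
  where
  open ≡-Reasoning
  g∘index≡h∘index : ∀ y → y ∈ toList xs → g (index env y) ≡ h (index env y)
  g∘index≡h∘index y y∈ with index env y | index-fvar-or-bvar env y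
  ... | _ | inj₁ refl       = g≡hᶠ y y∈
  ... | _ | inj₂ (i , refl) = g≡hᵇ i
sub-cong-vars env ⊥' g≡hᵇ g≡hᶠ = refl
sub-cong-vars env (φ ⇒' ψ) g≡hᵇ g≡hᶠ =
  cong₂ _⇒ⁿ_ (sub-cong-vars env φ g≡hᵇ (λ u → g≡hᶠ u ∘ ∈-++⁺ˡ))
             (sub-cong-vars env ψ g≡hᵇ (λ u → g≡hᶠ u ∘ ∈-++⁺ʳ (vars φ)))
sub-cong-vars env (φ ∧' ψ) g≡hᵇ g≡hᶠ =
  cong₂ _∧ⁿ_ (sub-cong-vars env φ g≡hᵇ (λ u → g≡hᶠ u ∘ ∈-++⁺ˡ))
             (sub-cong-vars env ψ g≡hᵇ (λ u → g≡hᶠ u ∘ ∈-++⁺ʳ (vars φ)))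
sub-cong-vars env (φ ⩒ ψ) g≡hᵇ g≡hᶠ =
  cong₂ _⩒ⁿ_ (sub-cong-vars env φ g≡hᵇ (λ u → g≡hᶠ u ∘ ∈-++⁺ˡ))
             (sub-cong-vars env ψ g≡hᵇ (λ u → g≡hᶠ u ∘ ∈-++⁺ʳ (vars φ)))
sub-cong-vars env (∀' x φ) g≡hᵇ g≡hᶠ =
  cong ∀ⁿ (sub-cong-vars (x ∷ env) φ (lift-cong-bvar g≡hᵇ) (λ u → cong shift ∘ g≡hᶠ u ∘ there))
sub-cong-vars env (∃̄ x φ) g≡hᵇ g≡hᶠ =
  cong ∃ⁿ (sub-cong-vars (x ∷ env) φ (lift-cong-bvar g≡hᵇ) (λ u → cong shift ∘ g≡hᶠ u ∘ there))

-- The binder that `renBinder` chooses for ∀' w φ under σ.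
binderName : (Var → Var) → Var → Fm → Var
binderName σ w φ =
  if any (λ v → σ v ≡ᵇ w) (fv (∀' w φ)) then suc (maxL (vars φ ++ map σ (fv φ)) ⊔ w) else w

fv-∀⁺ : ∀ {v w φ} → v ∈ fv φ → v ≢ w → v ∈ fv (∀' w φ)
fv-∀⁺ v∈ v≢w = ∈-filter⁺ _ v∈ (subst T (sym (if-≡ᵇ-≢ v≢w)) tt)

binderName-avoids : ∀ σ w φ {v} → v ∈ fv φ → v ≢ w → σ v ≢ binderName σ w φ
binderName-avoids σ w φ {v} v∈ v≢w
  with any (λ u → σ u ≡ᵇ w) (fv (∀' w φ)) | any⁺ {xs = fv (∀' w φ)} (λ u → σ u ≡ᵇ w)
... | false | noClash = λ σv≡w → noClash (lose (fv-∀⁺ {φ = φ} v∈ v≢w) (≡⇒≡ᵇ (σ v) w σv≡w))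
... | true  | _       = <⇒≢ (s≤s (≤-trans (≤-maxL ns σv∈) (m≤m⊔n (maxL ns) w)))
  where
  ns = vars φ ++ map σ (fv φ)
  σv∈ : σ v ∈ ns
  σv∈ = ∈-++⁺ʳ (vars φ) (∈-map⁺ σ v∈)

index-binder : ∀ σ w φ env env' g →
               (∀ v → v ∈ fv (∀' w φ) → index env' (σ v) ≡ g (index env v)) →
               ∀ v → v ∈ fv φ →
               index (binderName σ w φ ∷ env') ((σ [ w ↦ binderName σ w φ ]) v)
                 ≡ lift g (index (w ∷ env) v)
index-binder σ w φ env env' g agree v v∈ with v ≟ w
... | yes refl = begin
  index (w' ∷ env') ((σ [ v ↦ w' ]) v)  ≡⟨ cong (index (w' ∷ env')) (if-≡ᵇ-refl v) ⟩
  index (w' ∷ env') w'                  ≡⟨ index-here w' env' ⟩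
  bvar 0                                ≡⟨ cong (lift g) (index-here v env) ⟨
  lift g (index (v ∷ env) v)            ∎
  where open ≡-Reasoning
        w' = binderName σ w φ
... | no v≢w = begin
  index (w' ∷ env') ((σ [ w ↦ w' ]) v)  ≡⟨ cong (index (w' ∷ env')) (if-≡ᵇ-≢ v≢w) ⟩
  index (w' ∷ env') (σ v)               ≡⟨ index-there env' (binderName-avoids σ w φ v∈ v≢w) ⟩
  shift (index env' (σ v))              ≡⟨ cong shift (agree v (fv-∀⁺ {φ = φ} v∈ v≢w)) ⟩
  shift (g (index env v))               ≡⟨ lift-shift g (index env v) ⟨
  lift g (shift (index env v))          ≡⟨ cong (lift g) (index-there env v≢w) ⟨
  lift g (index (w ∷ env) v)            ∎
  where open ≡-Reasoning
        w' = binderName σ w φ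

toNameless-ren : ∀ φ σ env env' g → (∀ v → v ∈ fv φ → index env' (σ v) ≡ g (index env v)) →
                 toNameless env' (ren σ φ) ≡ sub g (toNameless env φ)
toNameless-ren (atom P xs) σ env env' g agree = cong (atomⁿ P) (begin
  Vec.map (index env') (Vec.map σ xs)  ≡⟨ map-∘ (index env') σ xs ⟨
  Vec.map (index env' ∘ σ) xs          ≡⟨ map-cong-∈ xs agree ⟩
  Vec.map (g ∘ index env) xs           ≡⟨ map-∘ g (index env) xs ⟩
  Vec.map g (Vec.map (index env) xs)   ∎)
  where open ≡-Reasoning
toNameless-ren ⊥' σ env env' g agree = refl
toNameless-ren (φ ⇒' ψ) σ env env' g agree =
  cong₂ _⇒ⁿ_ (toNameless-ren φ σ env env' g (λ v → agree v ∘ ∈-++⁺ˡ))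
             (toNameless-ren ψ σ env env' g (λ v → agree v ∘ ∈-++⁺ʳ (fv φ)))
toNameless-ren (φ ∧' ψ) σ env env' g agree =
  cong₂ _∧ⁿ_ (toNameless-ren φ σ env env' g (λ v → agree v ∘ ∈-++⁺ˡ))
             (toNameless-ren ψ σ env env' g (λ v → agree v ∘ ∈-++⁺ʳ (fv φ)))
toNameless-ren (φ ⩒ ψ) σ env env' g agree =
  cong₂ _⩒ⁿ_ (toNameless-ren φ σ env env' g (λ v → agree v ∘ ∈-++⁺ˡ))
             (toNameless-ren ψ σ env env' g (λ v → agree v ∘ ∈-++⁺ʳ (fv φ)))
toNameless-ren (∀' w φ) σ env env' g agree =
  cong ∀ⁿ (toNameless-ren φ _ (w ∷ env) _ (lift g) (index-binder σ w φ env env' g agree))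
toNameless-ren (∃̄ w φ) σ env env' g agree =
  cong ∃ⁿ (toNameless-ren φ _ (w ∷ env) _ (lift g) (index-binder σ w φ env env' g agree))

⌊[/]⌋ : ∀ φ z x → ⌊ φ [ z / x ] ⌋ ≡ sub (inst z) (toNameless [ x ] φ)
⌊[/]⌋ φ z x = toNameless-ren φ _ [ x ] [] (inst z) agree
  where
  agree : ∀ v → v ∈ fv φ → fvar (if v ≡ᵇ x then z else v) ≡ inst z (index [ x ] v)
  agree v _ with v ≡ᵇ x
  ... | true  = refl
  ... | false = refl

Variant : (Var → Var) → Fm → Fm → Set
Variant σ φ ψ = ⌊ ψ ⌋ ≡ sub (free σ) ⌊ φ ⌋

BinderVariant : (Var → Var) → Var → Fm → Var → Fm → Set
BinderVariant σ x φ x' φ' = toNameless [ x' ] φ' ≡ sub (lift (free σ)) (toNameless [ x ] φ)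

atomⁿ-injective : ∀ {P Q ts us} → atomⁿ P ts ≡ atomⁿ Q us →
                  Σ (P ≡ Q) λ P≡Q → subst (Vec Term ∘ arity) P≡Q ts ≡ us
atomⁿ-injective refl = refl , refl

map-fvar-injective : ∀ {n} {xs ys : Vec Var n} → Vec.map fvar xs ≡ Vec.map fvar ys → xs ≡ ys
map-fvar-injective {xs = []ᵛ}     {[]ᵛ}     _ = refl
map-fvar-injective {xs = x ∷ᵛ xs} {y ∷ᵛ ys} e with ∷-injective e
... | refl , e' = cong (x ∷ᵛ_) (map-fvar-injective e')

atom-variant⁻¹ : ∀ {σ P xs} ψ → Variant σ (atom P xs) ψ → ψ ≡ atom P (Vec.map σ xs)
atom-variant⁻¹ {σ} {xs = xs} (atom P ys) e with atomⁿ-injective e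
... | refl , ys≡ = cong (atom P) (map-fvar-injective (≡-trans ys≡ map-free-fvar))
  where
  map-free-fvar : Vec.map (free σ) (Vec.map fvar xs) ≡ Vec.map fvar (Vec.map σ xs)
  map-free-fvar = ≡-trans (sym (map-∘ (free σ) fvar xs)) (map-∘ fvar σ xs)
atom-variant⁻¹ ⊥'         ()
atom-variant⁻¹ (_ ⇒' _)   ()
atom-variant⁻¹ (_ ∧' _)   ()
atom-variant⁻¹ (_ ⩒ _)    ()
atom-variant⁻¹ (∀' _ _)   ()
atom-variant⁻¹ (∃̄ _ _)   ()

⌊⌋-⊥⁻¹ : ∀ ψ → ⌊ ψ ⌋ ≡ ⊥ⁿ → ψ ≡ ⊥'
⌊⌋-⊥⁻¹ ⊥'         refl = refl
⌊⌋-⊥⁻¹ (atom _ _) ()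
⌊⌋-⊥⁻¹ (_ ⇒' _)   ()
⌊⌋-⊥⁻¹ (_ ∧' _)   ()
⌊⌋-⊥⁻¹ (_ ⩒ _)    ()
⌊⌋-⊥⁻¹ (∀' _ _)   ()
⌊⌋-⊥⁻¹ (∃̄ _ _)   ()

⌊⌋-⇒⁻¹ : ∀ ψ {a b} → ⌊ ψ ⌋ ≡ a ⇒ⁿ b →
          ∃₂ λ ψ₁ ψ₂ → ψ ≡ ψ₁ ⇒' ψ₂ × ⌊ ψ₁ ⌋ ≡ a × ⌊ ψ₂ ⌋ ≡ b
⌊⌋-⇒⁻¹ (ψ₁ ⇒' ψ₂) refl = ψ₁ , ψ₂ , refl , refl , refl
⌊⌋-⇒⁻¹ (atom _ _) ()
⌊⌋-⇒⁻¹ ⊥'         ()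
⌊⌋-⇒⁻¹ (_ ∧' _)   ()
⌊⌋-⇒⁻¹ (_ ⩒ _)    ()
⌊⌋-⇒⁻¹ (∀' _ _)   ()
⌊⌋-⇒⁻¹ (∃̄ _ _)   ()

⌊⌋-∧⁻¹ : ∀ ψ {a b} → ⌊ ψ ⌋ ≡ a ∧ⁿ b →
          ∃₂ λ ψ₁ ψ₂ → ψ ≡ ψ₁ ∧' ψ₂ × ⌊ ψ₁ ⌋ ≡ a × ⌊ ψ₂ ⌋ ≡ b
⌊⌋-∧⁻¹ (ψ₁ ∧' ψ₂) refl = ψ₁ , ψ₂ , refl , refl , refl
⌊⌋-∧⁻¹ (atom _ _) ()
⌊⌋-∧⁻¹ ⊥'         ()
⌊⌋-∧⁻¹ (_ ⇒' _)   ()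
⌊⌋-∧⁻¹ (_ ⩒ _)    ()
⌊⌋-∧⁻¹ (∀' _ _)   ()
⌊⌋-∧⁻¹ (∃̄ _ _)   ()

⌊⌋-⩒⁻¹ : ∀ ψ {a b} → ⌊ ψ ⌋ ≡ a ⩒ⁿ b →
          ∃₂ λ ψ₁ ψ₂ → ψ ≡ ψ₁ ⩒ ψ₂ × ⌊ ψ₁ ⌋ ≡ a × ⌊ ψ₂ ⌋ ≡ b
⌊⌋-⩒⁻¹ (ψ₁ ⩒ ψ₂)  refl = ψ₁ , ψ₂ , refl , refl , refl
⌊⌋-⩒⁻¹ (atom _ _) ()
⌊⌋-⩒⁻¹ ⊥'         ()
⌊⌋-⩒⁻¹ (_ ⇒' _)   ()
⌊⌋-⩒⁻¹ (_ ∧' _)   ()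
⌊⌋-⩒⁻¹ (∀' _ _)   ()
⌊⌋-⩒⁻¹ (∃̄ _ _)   ()

⌊⌋-∀⁻¹ : ∀ ψ {a} → ⌊ ψ ⌋ ≡ ∀ⁿ a →
          ∃₂ λ x' φ' → ψ ≡ ∀' x' φ' × toNameless [ x' ] φ' ≡ a
⌊⌋-∀⁻¹ (∀' x' φ') refl = x' , φ' , refl , refl
⌊⌋-∀⁻¹ (atom _ _) ()
⌊⌋-∀⁻¹ ⊥'         ()
⌊⌋-∀⁻¹ (_ ⇒' _)   ()
⌊⌋-∀⁻¹ (_ ∧' _)   ()
⌊⌋-∀⁻¹ (_ ⩒ _)    ()
⌊⌋-∀⁻¹ (∃̄ _ _)   ()

⌊⌋-∃̄⁻¹ : ∀ ψ {a} → ⌊ ψ ⌋ ≡ ∃ⁿ a →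
          ∃₂ λ x' φ' → ψ ≡ ∃̄ x' φ' × toNameless [ x' ] φ' ≡ a
⌊⌋-∃̄⁻¹ (∃̄ x' φ') refl = x' , φ' , refl , refl
⌊⌋-∃̄⁻¹ (atom _ _) ()
⌊⌋-∃̄⁻¹ ⊥'         ()
⌊⌋-∃̄⁻¹ (_ ⇒' _)   ()
⌊⌋-∃̄⁻¹ (_ ∧' _)   ()
⌊⌋-∃̄⁻¹ (_ ⩒ _)    ()
⌊⌋-∃̄⁻¹ (∀' _ _)   ()

update-∉ : ∀ σ {z z' u vs} → z ∉ vs → u ∈ vs → (σ [ z ↦ z' ]) u ≡ σ u
update-∉ σ {vs = vs} z∉ u∈ = if-≡ᵇ-≢ (λ u≡z → z∉ (subst (_∈ vs) u≡z u∈))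

variant-update : ∀ {σ φ ψ} z z' → z ∉ vars φ → Variant σ φ ψ → Variant (σ [ z ↦ z' ]) φ ψ
variant-update {σ} {φ} z z' z∉ e =
  ≡-trans e (sub-cong-vars [] φ (λ _ → refl) (λ u → cong fvar ∘ sym ∘ update-∉ σ z∉))

variant-open : ∀ {σ τ x φ x' φ'} z z' → τ z ≡ z' → (∀ u → u ∈ vars φ → σ u ≡ τ u) →
               BinderVariant σ x φ x' φ' → Variant τ (φ [ z / x ]) (φ' [ z' / x' ])
variant-open {σ} {τ} {x} {φ} {x'} {φ'} z z' τz≡z' σ≡τ body = begin
  ⌊ φ' [ z' / x' ] ⌋                                     ≡⟨ ⌊[/]⌋ φ' z' x' ⟩
  sub (inst z') (toNameless [ x' ] φ')                   ≡⟨ cong (sub (inst z')) body ⟩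
  sub (inst z') (sub (lift (free σ)) (toNameless [ x ] φ)) ≡⟨ sub-∘ (inst z') (lift (free σ)) _ ⟩
  sub (inst z' ∘ lift (free σ)) (toNameless [ x ] φ)     ≡⟨ sub-cong-vars [ x ] φ agreeᵇ agreeᶠ ⟩
  sub (free τ ∘ inst z) (toNameless [ x ] φ)             ≡⟨ sub-∘ (free τ) (inst z) _ ⟨
  sub (free τ) (sub (inst z) (toNameless [ x ] φ))       ≡⟨ cong (sub (free τ)) (⌊[/]⌋ φ z x) ⟨
  sub (free τ) ⌊ φ [ z / x ] ⌋                           ∎
  where
  open ≡-Reasoning
  agreeᵇ : ∀ i → inst z' (lift (free σ) (bvar i)) ≡ free τ (inst z (bvar i))
  agreeᵇ zero    = cong fvar (sym τz≡z')
  agreeᵇ (suc i) = refl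
  agreeᶠ : ∀ u → u ∈ vars φ → inst z' (lift (free σ) (fvar u)) ≡ free τ (inst z (fvar u))
  agreeᶠ u = cong fvar ∘ σ≡τ u

variant-instance : ∀ {σ x φ x' φ'} y →
                   BinderVariant σ x φ x' φ' → Variant σ (φ [ y / x ]) (φ' [ σ y / x' ])
variant-instance y = variant-open y _ refl (λ _ _ → refl)

variant-eigen : ∀ {σ x φ x' φ' z} z' → z ∉ vars φ →
                BinderVariant σ x φ x' φ' → Variant (σ [ z ↦ z' ]) (φ [ z / x ]) (φ' [ z' / x' ])
variant-eigen {σ} {z = z} z' z∉ = variant-open z z' (if-≡ᵇ-refl z) (λ _ → sym ∘ update-∉ σ z∉)

Variantᴸ : (Label → Label → Set) → (Var → Var) → LFm → LFm → Set
Variantᴸ R σ A A' = R (lab A) (lab A') × Variant σ (fm A) (fm A')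

variant-refl : ∀ φ → Variant (λ v → v) φ φ
variant-refl φ = sym (sub-id free-id ⌊ φ ⌋)

identity-variants : ∀ R → (∀ X → R X X) → ∀ Γ → Pointwise (Variantᴸ R (λ v → v)) Γ Γ
identity-variants R R-refl Γ = Pointwise.refl (λ {A} → R-refl (lab A) , variant-refl (fm A))

Pointwise-update : ∀ {R σ Γ Γ'} z z' → z ∉ varsCtx Γ →
                   Pointwise (Variantᴸ R σ) Γ Γ' → Pointwise (Variantᴸ R (σ [ z ↦ z' ])) Γ Γ'
Pointwise-update z z' z∉ [] = []
Pointwise-update {Γ = A ∷ Γ} z z' z∉ ((r , e) ∷ rs) =
  (r , variant-update z z' (z∉ ∘ ∈-++⁺ˡ) e) ∷ Pointwise-update z z' (z∉ ∘ ∈-++⁺ʳ (vars (fm A))) rs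

⊆L-refl : ∀ X → X ⊆L X
⊆L-refl X _ k∈ = k∈

sing-least-⊆L : ∀ X → sing (least X) ⊆L X
sing-least-⊆L X _ (here k≡) = here k≡

Pointwise-↭ : ∀ {A B : Set} {R : A → B → Set} {xs ys ys'} → xs ↭ ys → Pointwise R ys ys' →
              ∃ λ xs' → Pointwise R xs xs' × xs' ↭ ys'
Pointwise-↭ {ys' = ys'} refl rs = ys' , rs , refl
Pointwise-↭ (prep x p) (r ∷ rs) with Pointwise-↭ p rs
... | _ , rs' , p' = _ , r ∷ rs' , prep _ p'
Pointwise-↭ (swap x y p) (r₁ ∷ r₂ ∷ rs) with Pointwise-↭ p rs
... | _ , rs' , p' = _ , r₂ ∷ r₁ ∷ rs' , swap _ _ p'
Pointwise-↭ (trans p q) rs with Pointwise-↭ q rs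
... | _ , rs' , q' with Pointwise-↭ p rs'
...   | _ , rs'' , p' = _ , rs'' , trans p' q'

∉-eigen⁻ : ∀ {z} vs Γ Δ → z ∉ vs ++ varsCtx Γ ++ varsCtx Δ →
           z ∉ vs × z ∉ varsCtx Γ × z ∉ varsCtx Δ
∉-eigen⁻ vs Γ Δ z∉ = z∉ ∘ ∈-++⁺ˡ , z∉ ∘ ∈-++⁺ʳ vs ∘ ∈-++⁺ˡ , z∉ ∘ ∈-++⁺ʳ vs ∘ ∈-++⁺ʳ (varsCtx Γ)

module _ (EL ER : List LFm) where

  ⊢-variant : ∀ {Γ Δ} → ⊢ Γ ⇒ Δ → ∀ σ {Γ' Δ'} →
              Pointwise (Variantᴸ _⊆L_ σ) Γ Γ' → Pointwise (Variantᴸ (flip _⊆L_) σ) Δ Δ' →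
              ⊢ Γ' ++ EL ⇒ Δ' ++ ER
  ⊢-variant (perm p q d) σ rsˡ rsʳ with Pointwise-↭ p rsˡ | Pointwise-↭ q rsʳ
  ... | _ , rsˡ' , p' | _ , rsʳ' , q' = perm (++⁺ʳ EL p') (++⁺ʳ ER q') (⊢-variant d σ rsˡ' rsʳ')
  ⊢-variant (id Y⊆X) σ {(_ ∶ ψ) ∷ _} {(_ ∶ χ) ∷ _} ((X⊆X' , e) ∷ _) ((Y'⊆Y , e') ∷ _)
    with atom-variant⁻¹ ψ e | atom-variant⁻¹ χ e'
  ... | refl | refl = id (λ k → X⊆X' k ∘ Y⊆X k ∘ Y'⊆Y k)
  ⊢-variant ⊥⇒ σ {(_ ∶ ψ) ∷ _} ((_ , e) ∷ _) rsʳ with ⌊⌋-⊥⁻¹ ψ e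
  ... | refl = ⊥⇒
  ⊢-variant (⇒at d) σ {Δ' = (_ ∶ ψ) ∷ _} rsˡ ((X'⊆X , e) ∷ rsʳ) with atom-variant⁻¹ ψ e
  ... | refl = ⇒at λ k k∈ → ⊢-variant (d k (X'⊆X k k∈)) σ rsˡ ((⊆L-refl (sing k) , e) ∷ rsʳ)
  ⊢-variant (⇒∧ d₁ d₂) σ {Δ' = (_ ∶ ψ) ∷ _} rsˡ ((s , e) ∷ rsʳ) with ⌊⌋-∧⁻¹ ψ e
  ... | _ , _ , refl , e₁ , e₂ =
    ⇒∧ (⊢-variant d₁ σ rsˡ ((s , e₁) ∷ rsʳ)) (⊢-variant d₂ σ rsˡ ((s , e₂) ∷ rsʳ))
  ⊢-variant (∧⇒ d) σ {(_ ∶ ψ) ∷ _} ((s , e) ∷ rsˡ) rsʳ with ⌊⌋-∧⁻¹ ψ e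
  ... | _ , _ , refl , e₁ , e₂ = ∧⇒ (⊢-variant d σ ((s , e₁) ∷ (s , e₂) ∷ rsˡ) rsʳ)
  ⊢-variant (⇒⩒ d) σ {Δ' = (_ ∶ ψ) ∷ _} rsˡ ((s , e) ∷ rsʳ) with ⌊⌋-⩒⁻¹ ψ e
  ... | _ , _ , refl , e₁ , e₂ = ⇒⩒ (⊢-variant d σ rsˡ ((s , e₁) ∷ (s , e₂) ∷ rsʳ))
  ⊢-variant (⩒⇒ d₁ d₂) σ {(_ ∶ ψ) ∷ _} ((s , e) ∷ rsˡ) rsʳ with ⌊⌋-⩒⁻¹ ψ e
  ... | _ , _ , refl , e₁ , e₂ =
    ⩒⇒ (⊢-variant d₁ σ ((s , e₁) ∷ rsˡ) rsʳ) (⊢-variant d₂ σ ((s , e₂) ∷ rsˡ) rsʳ)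
  ⊢-variant (⇒→ d) σ {Δ' = (_ ∶ ψ) ∷ _} rsˡ ((X'⊆X , e) ∷ rsʳ) with ⌊⌋-⇒⁻¹ ψ e
  ... | _ , _ , refl , e₁ , e₂ = ⇒→ λ Y Y⊆X' →
    ⊢-variant (d Y (λ k → X'⊆X k ∘ Y⊆X' k)) σ ((⊆L-refl Y , e₁) ∷ rsˡ) ((⊆L-refl Y , e₂) ∷ rsʳ)
  ⊢-variant (→⇒ {Y = Y} Y⊆X d₁ d₂) σ {(_ ∶ ψ) ∷ _} ((X⊆X' , e) ∷ rsˡ) rsʳ with ⌊⌋-⇒⁻¹ ψ e
  ... | _ , _ , refl , e₁ , e₂ = →⇒ {Y = Y} (λ k → X⊆X' k ∘ Y⊆X k)
    (⊢-variant d₁ σ ((X⊆X' , e) ∷ rsˡ) ((⊆L-refl Y , e₁) ∷ rsʳ))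
    (⊢-variant d₂ σ ((⊆L-refl Y , e₂) ∷ (X⊆X' , e) ∷ rsˡ) rsʳ)
  -- The eigenvariable z may occur in EL or ER, so it is renamed to one fresh for the new sequent.
  ⊢-variant (⇒∀ {x = x} {z} {φ} {Γ} {Δ} z∉ d) σ {Γ'} {(_ ∶ ψ) ∷ Δ'} rsˡ ((s , e) ∷ rsʳ)
    with ⌊⌋-∀⁻¹ ψ e | ∉-eigen⁻ (vars (∀' x φ)) Γ Δ z∉
  ... | x' , φ' , refl , body | z∉∀φ , z∉Γ , z∉Δ = ⇒∀ (suc-maxL-∉ ns)
    (⊢-variant d (σ [ z ↦ z' ]) (Pointwise-update z z' z∉Γ rsˡ)
      ((s , variant-eigen z' (z∉∀φ ∘ there) body) ∷ Pointwise-update z z' z∉Δ rsʳ))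
    where
    ns = vars (∀' x' φ') ++ varsCtx (Γ' ++ EL) ++ varsCtx (Δ' ++ ER)
    z' = suc (maxL ns)
  ⊢-variant (∀⇒ {y = y} d) σ {(_ ∶ ψ) ∷ _} ((s , e) ∷ rsˡ) rsʳ with ⌊⌋-∀⁻¹ ψ e
  ... | _ , _ , refl , body =
    ∀⇒ {y = σ y} (⊢-variant d σ ((s , variant-instance y body) ∷ (s , e) ∷ rsˡ) rsʳ)
  ⊢-variant (⇒∃̄ {y = y} d) σ {Δ' = (_ ∶ ψ) ∷ _} rsˡ ((s , e) ∷ rsʳ) with ⌊⌋-∃̄⁻¹ ψ e
  ... | _ , _ , refl , body =
    ⇒∃̄ {y = σ y} (⊢-variant d σ rsˡ ((s , e) ∷ (s , variant-instance y body) ∷ rsʳ))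
  ⊢-variant (∃̄⇒ {x = x} {z} {φ} {Γ} {Δ} z∉ d) σ {(_ ∶ ψ) ∷ Γ'} {Δ'} ((s , e) ∷ rsˡ) rsʳ
    with ⌊⌋-∃̄⁻¹ ψ e | ∉-eigen⁻ (vars (∃̄ x φ)) Γ Δ z∉
  ... | x' , φ' , refl , body | z∉∃φ , z∉Γ , z∉Δ = ∃̄⇒ (suc-maxL-∉ ns)
    (⊢-variant d (σ [ z ↦ z' ])
      ((s , variant-eigen z' (z∉∃φ ∘ there) body) ∷ Pointwise-update z z' z∉Γ rsˡ)
      (Pointwise-update z z' z∉Δ rsʳ))
    where
    ns = vars (∃̄ x' φ') ++ varsCtx (Γ' ++ EL) ++ varsCtx (Δ' ++ ER)
    z' = suc (maxL ns)

⊢-weaken : ∀ {Γ Δ} EL ER → ⊢ Γ ⇒ Δ → ⊢ EL ++ Γ ⇒ ER ++ Δ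
⊢-weaken {Γ} {Δ} EL ER d = perm (++-comm Γ EL) (++-comm Δ ER)
  (⊢-variant EL ER d (λ v → v) (identity-variants _⊆L_ ⊆L-refl Γ) (identity-variants _ ⊆L-refl Δ))

⊢-enlargeˡ : ∀ {X Y φ Γ Δ} → Y ⊆L X → ⊢ (Y ∶ φ) ∷ Γ ⇒ Δ → ⊢ (X ∶ φ) ∷ Γ ⇒ Δ
⊢-enlargeˡ {φ = φ} {Γ} {Δ} Y⊆X d = perm (++-identityʳ _) (++-identityʳ _)
  (⊢-variant [] [] d (λ v → v)
    ((Y⊆X , variant-refl φ) ∷ identity-variants _⊆L_ ⊆L-refl Γ) (identity-variants _ ⊆L-refl Δ))

⇒¬-admissible : (X : Label) (φ : Fm) (Γ Δ : List LFm) →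
                (∀ k → k ∈L X → ⊢ (sing k ∶ φ) ∷ Γ ⇒ Δ) →
                ⊢ Γ ⇒ (X ∶ ¬' φ) ∷ Δ
⇒¬-admissible X φ Γ Δ premise = ⇒→ λ Y Y⊆X →
  ⊢-weaken [] [ Y ∶ ⊥' ] (⊢-enlargeˡ (sing-least-⊆L Y) (premise (least Y) (Y⊆X _ (here refl))))

¬⇒-admissible : (X Y : Label) (φ : Fm) (Γ Δ : List LFm) → Y ⊆L X →
                ⊢ Γ ⇒ (Y ∶ φ) ∷ Δ →
                ⊢ (X ∶ ¬' φ) ∷ Γ ⇒ Δ
¬⇒-admissible X Y φ Γ Δ Y⊆X d = →⇒ Y⊆X (⊢-weaken [ X ∶ ¬' φ ] [] d) ⊥⇒

corollary4 : ((X : Label) (φ : Fm) (Γ Δ : List LFm) →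
                  (∀ k → k ∈L X → ⊢ (sing k ∶ φ) ∷ Γ ⇒ Δ) →
                  ⊢ Γ ⇒ (X ∶ ¬' φ) ∷ Δ)
             × ((X Y : Label) (φ : Fm) (Γ Δ : List LFm) → Y ⊆L X →
                  ⊢ Γ ⇒ (Y ∶ φ) ∷ Δ →
                  ⊢ (X ∶ ¬' φ) ∷ Γ ⇒ Δ)
corollary4 = ⇒¬-admissible , ¬⇒-admissible
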